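{- For every integer $n\ge 12$ there exists a $2$-connected simple graph $G$ on $n$ vertices containing no cycle whose length is divisible by $4$ and having exactly $\left\lfloor\frac{3n-1}{2}\right\rfloor$ edges. -}

module Defs where

open import Data.Nat using (ℕ; zero; suc; _+_; _≤_)
open import Data.Bool using (Bool; true; false; if_then_else_)
open import Data.Fin using (Fin; zero; suc; inject₁; fromℕ; _<?_)
open import Data.List using (List; allFin; map)
open import Data.Nat.ListAction using (sum)
open import Data.Product using (_×_; ∃)
open import Relation.Nullary using (¬_)
open import Data.Unit using (⊤)
open import Data.Nat.Divisibility using (_∣_)
open import Relation.Nullary.Decidable using (⌊_⌋)
open import Relation.Binary.PropositionalEquality using (_≡_)
open import Function.Definitions using (Injective)

record Graph (n : ℕ) : Set where
  field
    adj    : Fin n → Fin n → Bool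
    sym    : ∀ i j → adj i j ≡ adj j i
    irrefl : ∀ i → adj i i ≡ false
open Graph public

Adj : ∀ {n} → Graph n → Fin n → Fin n → Set
Adj G i j = adj G i j ≡ true

edgeCount : ∀ {n} → Graph n → ℕ
edgeCount {n} G =
  sum (map (λ i → sum (map (λ j →
    if ⌊ i <? j ⌋ then (if adj G i j then 1 else 0) else 0) (allFin n))) (allFin n))

data Reach {n} (G : Graph n) (P : Fin n → Set) : Fin n → Fin n → Set where
  here : ∀ {u} → P u → Reach G P u u
  step : ∀ {u v w} → P u → Adj G u v → Reach G P v w → Reach G P u w

ConnectedOn : ∀ {n} → Graph n → (Fin n → Set) → Set
ConnectedOn G P = ∀ u v → P u → P v → Reach G P u v

Connected : ∀ {n} → Graph n → Set
Connected G = ConnectedOn G (λ _ → ⊤)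

-- 2-connected (Diestel): more than 2 vertices, connected, and G − w is
-- connected for every vertex w.
TwoConnected : ∀ {n} → Graph n → Set
TwoConnected {n} G = (3 ≤ n) × Connected G × (∀ w → ConnectedOn G (λ v → ¬ (v ≡ w)))

-- A cycle of length k = 3 + m: k distinct vertices c 0, …, c (k-1) with
-- c i ~ c (i+1) and c (k-1) ~ c 0.
record Cycle {n} (G : Graph n) (m : ℕ) : Set where
  field
    c      : Fin (3 + m) → Fin n
    inj    : Injective _≡_ _≡_ c
    consec : ∀ (i : Fin (2 + m)) → Adj G (c (inject₁ i)) (c (suc i))
    close  : Adj G (c (fromℕ (2 + m))) (c zero)

NoCycleLen0mod4 : ∀ {n} → Graph n → Set
NoCycleLen0mod4 G = ∀ m → 4 ∣ (3 + m) → ¬ Cycle G m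

module Submission where

-- Start from a 2-connected graph H without cycles of length 0 mod 4 that has ⌊(3n − 1)/2⌋ edges
-- (H₈ on 8 and H₁₃ on 13 vertices) and attach k parallel paths u – a – b – v of length 3 between
-- two fixed vertices u ≠ v. Every such ear keeps the graph 2-connected and adds two vertices and
-- three edges, which keeps the edge count at ⌊(3n − 1)/2⌋. Ears create no new cycle lengths: the
-- vertices a have degree 2 and the common neighbour u, so a cycle meets at most two of any three
-- ears, and folding an ear it misses onto another one maps it to a cycle of the same length in the
-- graph with one ear fewer. So all cycle lengths already occur with two ears, where lengths 0 mod 4
-- are excluded by exhaustive search; every n ≥ 12 is 8 + 2k with k ≥ 2 or 13 + 2k.

open import Defs hiding (sym)
open import Data.Nat using (ℕ; zero; suc; _+_; _*_; _∸_; _/_; _%_; _≤_; _<_; s≤s; z≤n; s≤s⁻¹; s<s⁻¹; _≡ᵇ_)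
open import Data.Nat.Divisibility using (_∣_; n∣m⇒m%n≡0)
import Data.Nat.Properties as ℕ
open import Data.Nat.DivMod using (m/n≡1+[m∸n]/n)
open import Data.Nat.ListAction using (sum)
open import Data.Bool using (Bool; true; false; not; _∧_; _∨_; if_then_else_)
open import Data.Bool.Properties using (∧-conicalˡ; ∧-conicalʳ; not-involutive) renaming (_≟_ to _≟ᵇ_)
open import Data.Fin using (Fin; zero; suc; _<?_; fromℕ; fromℕ<; inject₁; toℕ; #_)
open import Data.Fin.Relation.Unary.Top using (view; ‵fromℕ; ‵inject₁; view-fromℕ; view-inject₁)
open import Data.Fin.Properties
  using (_≟_; suc-injective; any?; toℕ-injective; toℕ-inject₁; toℕ-fromℕ; toℕ-fromℕ<; fromℕ<-injective; injective⇒≤)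
open import Data.List using (tabulate)
open import Data.List.Properties using (map-tabulate; tabulate-cong)
open import Data.Vec using (Vec; []; _∷_; lookup; replicate; _[_]≔_)
open import Data.Vec.Properties using (lookup∘update′; lookup-replicate)
open import Data.Product using (Σ; ∃; _×_; _,_; proj₁)
open import Data.Sum using (_⊎_; inj₁; inj₂)
open import Data.Unit using (⊤; tt)
open import Data.Empty using (⊥; ⊥-elim)
open import Function using (id; _∘_)
open import Relation.Nullary using (¬_; Dec; yes; no; does)
open import Relation.Nullary.Decidable using (⌊_⌋; ¬?; dec-true; isYes≗does)
open import Relation.Binary.PropositionalEquality using (_≡_; refl; sym; trans; cong; subst; module ≡-Reasoning)

does-sound : ∀ {A : Set} (a? : Dec A) → does a? ≡ true → A
does-sound (yes a) _ = a

allᵇ : ∀ {n} → (Fin n → Bool) → Bool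
allᵇ {zero}  f = true
allᵇ {suc n} f = f zero ∧ allᵇ (f ∘ suc)

allᵇ-sound : ∀ {n} (f : Fin n → Bool) → allᵇ f ≡ true → ∀ i → f i ≡ true
allᵇ-sound {suc n} f e zero    = ∧-conicalˡ (f zero) _ e
allᵇ-sound {suc n} f e (suc i) = allᵇ-sound (f ∘ suc) (∧-conicalʳ (f zero) _ e) i

modusPonensᵇ : ∀ {a b} → (not a ∨ b) ≡ true → a ≡ true → b ≡ true
modusPonensᵇ e refl = e

retract⇒injective : ∀ {I A B : Set} {c : I → A} (f : A → B) (g : B → A) →
                    (∀ i → g (f (c i)) ≡ c i) → ∀ i j → f (c i) ≡ f (c j) → c i ≡ c j
retract⇒injective f g r i j e = trans (sym (r i)) (trans (cong g e) (r j))

≟-diag : ∀ {n} (x : Fin n) → does (x ≟ x) ≡ true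
≟-diag x = dec-true (x ≟ x) refl

Adj-sym : ∀ {n} (G : Graph n) {x y} → Adj G x y → Adj G y x
Adj-sym G {x} {y} a = trans (Graph.sym G y x) a

module _ {n} {G : Graph n} {P : Fin n → Set} where

  Reach-trans : ∀ {x y z} → Reach G P x y → Reach G P y z → Reach G P x z
  Reach-trans (here _)     q = q
  Reach-trans (step p a r) q = step p a (Reach-trans r q)

  Reach-source : ∀ {x y} → Reach G P x y → P x
  Reach-source (here p)     = p
  Reach-source (step p _ _) = p

  Reach-sym : ∀ {x y} → Reach G P x y → Reach G P y x
  Reach-sym (here p)     = here p
  Reach-sym (step p a r) = Reach-trans (Reach-sym r) (step (Reach-source r) (Adj-sym G a) (here p))

  connectedOn-viaRoot : ∀ r → (∀ x → P x → Reach G P x r) → ConnectedOn G P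
  connectedOn-viaRoot r toRoot x y px py = Reach-trans (toRoot x px) (Reach-sym (toRoot y py))

-- ear G u v attaches a new path u – new₀ – new₁ – v; old vertices are shifted by two.
pattern new₀ = zero
pattern new₁ = suc zero
pattern old x = suc (suc x)

earAdj : ∀ {n} → (Fin n → Fin n → Bool) → Fin n → Fin n → Fin (2 + n) → Fin (2 + n) → Bool
earAdj a u v new₀    new₀    = false
earAdj a u v new₀    new₁    = true
earAdj a u v new₀    (old y) = does (y ≟ u)
earAdj a u v new₁    new₀    = true
earAdj a u v new₁    new₁    = false
earAdj a u v new₁    (old y) = does (y ≟ v)
earAdj a u v (old x) new₀    = does (x ≟ u)
earAdj a u v (old x) new₁    = does (x ≟ v)
earAdj a u v (old x) (old y) = a x y

ear : ∀ {n} → Graph n → Fin n → Fin n → Graph (2 + n)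
ear G u v = record { adj = earAdj (adj G) u v ; sym = earAdj-sym ; irrefl = earAdj-irrefl }
  where
  earAdj-sym : ∀ x y → earAdj (adj G) u v x y ≡ earAdj (adj G) u v y x
  earAdj-sym new₀    new₀    = refl
  earAdj-sym new₀    new₁    = refl
  earAdj-sym new₀    (old y) = refl
  earAdj-sym new₁    new₀    = refl
  earAdj-sym new₁    new₁    = refl
  earAdj-sym new₁    (old y) = refl
  earAdj-sym (old x) new₀    = refl
  earAdj-sym (old x) new₁    = refl
  earAdj-sym (old x) (old y) = Graph.sym G x y

  earAdj-irrefl : ∀ x → earAdj (adj G) u v x x ≡ false
  earAdj-irrefl new₀    = refl
  earAdj-irrefl new₁    = refl
  earAdj-irrefl (old x) = Graph.irrefl G x

module _ {n} (G : Graph n) (u v : Fin n) where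

  ear-u : Adj (ear G u v) new₀ (old u)
  ear-u = ≟-diag u

  ear-v : Adj (ear G u v) new₁ (old v)
  ear-v = ≟-diag v

  ear-old : ∀ {P : Fin n → Set} {Q : Fin (2 + n) → Set} → (∀ z → P z → Q (old z)) →
            ∀ {x y} → Reach G P x y → Reach (ear G u v) Q (old x) (old y)
  ear-old PQ (here p)     = here (PQ _ p)
  ear-old PQ (step p a r) = step (PQ _ p) a (ear-old PQ r)

  edgeCount-ear : edgeCount (ear G u v) ≡ 3 + edgeCount G
  edgeCount-ear = begin
    edgeCount (ear G u v)   ≡⟨ edgeCount-tabulate (ear G u v) ⟩
    edgeCountᵗ (ear G u v)  ≡⟨ edgeCountᵗ-ear ⟩
    3 + edgeCountᵗ G        ≡⟨ cong (3 +_) (edgeCount-tabulate G) ⟨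
    3 + edgeCount G         ∎
    where
    open ≡-Reasoning
    edgeCountᵗ : ∀ {m} → Graph m → ℕ
    edgeCountᵗ H = sum (tabulate (λ i → sum (tabulate (λ j →
      if ⌊ i <? j ⌋ then (if adj H i j then 1 else 0) else 0))))

    edgeCount-tabulate : ∀ {m} (H : Graph m) → edgeCount H ≡ edgeCountᵗ H
    edgeCount-tabulate {m} H =
      trans (cong sum (map-tabulate {n = m} id _))
            (cong sum (tabulate-cong {n = m} (λ i → cong sum (map-tabulate {n = m} id _))))

    sum-indicator : ∀ {m} (w : Fin m) → sum (tabulate (λ y → if does (y ≟ w) then 1 else 0)) ≡ 1
    sum-indicator {suc m} zero    = cong suc (sum-zeros m)
      where
      sum-zeros : ∀ k → sum (tabulate {n = k} (λ _ → 0)) ≡ 0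
      sum-zeros zero    = refl
      sum-zeros (suc k) = sum-zeros k
    sum-indicator {suc m} (suc w) = sum-indicator w

    <?-old : ∀ {m} (i j : Fin m) → ⌊ old i <? old j ⌋ ≡ ⌊ i <? j ⌋
    <?-old i j = trans (isYes≗does (old i <? old j)) (sym (isYes≗does (i <? j)))

    -- The new vertices come first, so they only count in their own rows: new₀ – new₁, new₀ – old u
    -- and new₁ – old v.
    edgeCountᵗ-ear : edgeCountᵗ (ear G u v) ≡ 3 + edgeCountᵗ G
    edgeCountᵗ-ear rewrite sum-indicator u | sum-indicator v =
      cong (3 +_) (cong sum (tabulate-cong λ i → cong sum (tabulate-cong λ j →
        cong (λ b → if b then (if adj G i j then 1 else 0) else 0) (<?-old i j))))

ear-TwoConnected : ∀ {n} (G : Graph n) u v → ¬ u ≡ v → TwoConnected G → TwoConnected (ear G u v)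
ear-TwoConnected {n} G u v u≢v (3≤n , conn , conn-∖) =
  ℕ.≤-trans 3≤n (ℕ.m≤n+m n 2) , conn′ , conn′-∖
  where
  E = ear G u v

  conn′ : Connected E
  conn′ = connectedOn-viaRoot (old u) toOld-u
    where
    toOld-u : ∀ x → ⊤ → Reach E (λ _ → ⊤) x (old u)
    toOld-u new₀    _ = step tt (ear-u G u v) (here tt)
    toOld-u new₁    _ = step {v = new₀} tt refl (step tt (ear-u G u v) (here tt))
    toOld-u (old x) _ = ear-old G u v _ (conn x u tt tt)

  old≢ : ∀ {x w} → ¬ x ≡ w → ¬ old x ≡ old w
  old≢ x≢w e = x≢w (suc-injective (suc-injective e))

  conn′-∖ : ∀ w → ConnectedOn E (λ z → ¬ z ≡ w)
  conn′-∖ new₀ = connectedOn-viaRoot (old v) toOld-v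
    where
    toOld-v : ∀ x → ¬ x ≡ new₀ → Reach E (λ z → ¬ z ≡ new₀) x (old v)
    toOld-v new₀    x≢w = ⊥-elim (x≢w refl)
    toOld-v new₁    x≢w = step x≢w (ear-v G u v) (here λ ())
    toOld-v (old x) _   = ear-old G u v (λ _ _ ()) (conn x v tt tt)
  conn′-∖ new₁ = connectedOn-viaRoot (old u) toOld-u
    where
    toOld-u : ∀ x → ¬ x ≡ new₁ → Reach E (λ z → ¬ z ≡ new₁) x (old u)
    toOld-u new₀    x≢w = step x≢w (ear-u G u v) (here λ ())
    toOld-u new₁    x≢w = ⊥-elim (x≢w refl)
    toOld-u (old x) _   = ear-old G u v (λ _ _ ()) (conn x u tt tt)
  conn′-∖ (old w) with w ≟ u
  ... | yes refl = connectedOn-viaRoot (old v) toOld-v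
    where
    v≢w : ¬ old v ≡ old w
    v≢w = old≢ (λ e → u≢v (sym e))
    toOld-v : ∀ x → ¬ x ≡ old w → Reach E (λ z → ¬ z ≡ old w) x (old v)
    toOld-v new₀    x≢w = step {v = new₁} x≢w refl (step (λ ()) (ear-v G u v) (here v≢w))
    toOld-v new₁    x≢w = step x≢w (ear-v G u v) (here v≢w)
    toOld-v (old x) x≢w =
      ear-old G u v (λ _ → old≢) (conn-∖ w x v (λ e → x≢w (cong old e)) (λ e → u≢v (sym e)))
  ... | no w≢u = connectedOn-viaRoot (old u) toOld-u
    where
    u≢w : ¬ old u ≡ old w
    u≢w = old≢ (λ e → w≢u (sym e))
    toOld-u : ∀ x → ¬ x ≡ old w → Reach E (λ z → ¬ z ≡ old w) x (old u)
    toOld-u new₀    x≢w = step x≢w (ear-u G u v) (here u≢w)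
    toOld-u new₁    x≢w = step {v = new₀} x≢w refl (step (λ ()) (ear-u G u v) (here u≢w))
    toOld-u (old x) x≢w =
      ear-old G u v (λ _ → old≢) (conn-∖ w x u (λ e → x≢w (cong old e)) (λ e → w≢u (sym e)))

next : ∀ {k} → Fin (suc k) → Fin (suc k)
next i with view i
... | ‵fromℕ     = zero
... | ‵inject₁ j = suc j

prev : ∀ {k} → Fin (suc k) → Fin (suc k)
prev zero    = fromℕ _
prev (suc j) = inject₁ j

next-fromℕ : ∀ k → next (fromℕ k) ≡ zero
next-fromℕ k rewrite view-fromℕ k = refl

next-inject₁ : ∀ {k} (j : Fin k) → next (inject₁ j) ≡ suc j
next-inject₁ j rewrite view-inject₁ j = refl

next∘prev : ∀ {k} (i : Fin (suc k)) → next (prev i) ≡ i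
next∘prev {k} zero = next-fromℕ k
next∘prev (suc j)  = next-inject₁ j

prev∘next : ∀ {k} (i : Fin (suc k)) → prev (next i) ≡ i
prev∘next i with view i
... | ‵fromℕ     = refl
... | ‵inject₁ j = refl

prev²≢id : ∀ {m} (i : Fin (3 + m)) → ¬ prev (prev i) ≡ i
prev²≢id zero          = λ ()
prev²≢id (suc zero)    = λ ()
prev²≢id (suc (suc j)) = λ e →
  ℕ.m≢1+n+m (toℕ j) {1} (trans (sym (trans (toℕ-inject₁ (inject₁ j)) (toℕ-inject₁ j))) (cong toℕ e))

next≢prev : ∀ {m} (i : Fin (3 + m)) → ¬ next i ≡ prev i
next≢prev i e = prev²≢id i (trans (cong prev (sym e)) (prev∘next i))

NeighboursIn : ∀ {n} → Graph n → Fin n → Fin n → Fin n → Set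
NeighboursIn G x y z = ∀ t → Adj G x t → t ≡ y ⊎ t ≡ z

module _ {n} {G : Graph n} {m} (C : Cycle G m) where
  open Cycle C

  OnCycle : Fin n → Set
  OnCycle x = ∃ λ i → c i ≡ x

  Cycle-adj-next : ∀ i → Adj G (c i) (c (next i))
  Cycle-adj-next i with view i
  ... | ‵fromℕ     = close
  ... | ‵inject₁ j = consec j

  Cycle-adj-prev : ∀ i → Adj G (c i) (c (prev i))
  Cycle-adj-prev i =
    Adj-sym G (subst (λ j → Adj G (c (prev i)) (c j)) (next∘prev i) (Cycle-adj-next (prev i)))

  Cycle-neighbour : ∀ {i x y z} → c i ≡ x → NeighboursIn G x y z → c (next i) ≡ y ⊎ c (prev i) ≡ y
  Cycle-neighbour {i} refl N with N _ (Cycle-adj-next i) | N _ (Cycle-adj-prev i)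
  ... | inj₁ e | _      = inj₁ e
  ... | inj₂ _ | inj₁ e = inj₂ e
  ... | inj₂ e | inj₂ e′ = ⊥-elim (next≢prev i (inj (trans e (sym e′))))

  OnCycle-neighbour : ∀ {x y z} → NeighboursIn G x y z → OnCycle x → OnCycle y
  OnCycle-neighbour N (i , ci≡x) with Cycle-neighbour ci≡x N
  ... | inj₁ e = next i , e
  ... | inj₂ e = prev i , e

  hub-position : ∀ {x h b} → NeighboursIn G x h b → ((i , _) : OnCycle x) →
                 ∃ λ r → c r ≡ h × (i ≡ prev r ⊎ i ≡ next r)
  hub-position N (i , ci≡x) with Cycle-neighbour ci≡x N
  ... | inj₁ e = next i , e , inj₁ (sym (prev∘next i))
  ... | inj₂ e = prev i , e , inj₂ (sym (next∘prev i))

  -- The hub h has only two neighbours on the cycle.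
  Cycle-¬threeSpokes : ∀ {h a₁ b₁ a₂ b₂ a₃ b₃} → ¬ a₁ ≡ a₂ → ¬ a₁ ≡ a₃ → ¬ a₂ ≡ a₃ →
    NeighboursIn G a₁ h b₁ → NeighboursIn G a₂ h b₂ → NeighboursIn G a₃ h b₃ →
    OnCycle a₁ → OnCycle a₂ → OnCycle a₃ → ⊥
  Cycle-¬threeSpokes a₁≢a₂ a₁≢a₃ a₂≢a₃ N₁ N₂ N₃ o₁ o₂ o₃
    with hub-position N₁ o₁ | hub-position N₂ o₂ | hub-position N₃ o₃
  ... | r , cr≡h , s₁ | r₂ , cr₂≡h , s₂ | r₃ , cr₃≡h , s₃
    with inj (trans cr₂≡h (sym cr≡h)) | inj (trans cr₃≡h (sym cr≡h))
  ... | refl | refl = pigeonhole s₁ s₂ s₃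
    where
    same : ∀ {x y} ((i , _) : OnCycle x) ((j , _) : OnCycle y) → i ≡ j → x ≡ y
    same (i , ci≡x) (.i , ci≡y) refl = trans (sym ci≡x) ci≡y
    Beside : Fin (3 + m) → Set
    Beside q = q ≡ prev r ⊎ q ≡ next r
    pigeonhole : Beside (proj₁ o₁) → Beside (proj₁ o₂) → Beside (proj₁ o₃) → ⊥
    pigeonhole (inj₁ e₁) (inj₁ e₂) _ = a₁≢a₂ (same o₁ o₂ (trans e₁ (sym e₂)))
    pigeonhole (inj₂ e₁) (inj₂ e₂) _ = a₁≢a₂ (same o₁ o₂ (trans e₁ (sym e₂)))
    pigeonhole (inj₁ e₁) _ (inj₁ e₃) = a₁≢a₃ (same o₁ o₃ (trans e₁ (sym e₃)))
    pigeonhole (inj₂ e₁) _ (inj₂ e₃) = a₁≢a₃ (same o₁ o₃ (trans e₁ (sym e₃)))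
    pigeonhole _ (inj₁ e₂) (inj₁ e₃) = a₂≢a₃ (same o₂ o₃ (trans e₂ (sym e₃)))
    pigeonhole _ (inj₂ e₂) (inj₂ e₃) = a₂≢a₃ (same o₂ o₃ (trans e₂ (sym e₃)))

Hom : ∀ {n n′} → Graph n → Graph n′ → (Fin n → Fin n′) → Set
Hom G G′ f = ∀ x y → Adj G x y → Adj G′ (f x) (f y)

Cycle-map : ∀ {n n′} {G : Graph n} {G′ : Graph n′} {m} (f : Fin n → Fin n′) → Hom G G′ f →
            (C : Cycle G m) → (∀ i j → f (Cycle.c C i) ≡ f (Cycle.c C j) → Cycle.c C i ≡ Cycle.c C j) →
            Cycle G′ m
Cycle-map f hom C f-inj = record
  { c      = f ∘ c
  ; inj    = λ {i} {j} e → inj (f-inj i j e)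
  ; consec = λ i → hom _ _ (consec i)
  ; close  = hom _ _ close
  }
  where open Cycle C

ear-Cycle : ∀ {n} {G : Graph n} {u v m} → Cycle G m → Cycle (ear G u v) m
ear-Cycle C = Cycle-map old (λ _ _ a → a) C (λ _ _ e → suc-injective (suc-injective e))

ear-new₀-neighbours : ∀ {n} (G : Graph n) u v → NeighboursIn (ear G u v) new₀ (old u) new₁
ear-new₀-neighbours G u v new₁    _ = inj₂ refl
ear-new₀-neighbours G u v (old y) a = inj₁ (cong old (does-sound (y ≟ u) a))

ear-new₁-neighbours : ∀ {n} (G : Graph n) u v → NeighboursIn (ear G u v) new₁ new₀ (old v)
ear-new₁-neighbours G u v new₀    _ = inj₁ refl
ear-new₁-neighbours G u v (old y) a = inj₂ (cong old (does-sound (y ≟ v) a))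

ear-old-neighbours : ∀ {n} (G : Graph n) u v {x y z} → ¬ x ≡ u → ¬ x ≡ v → NeighboursIn G x y z →
                     NeighboursIn (ear G u v) (old x) (old y) (old z)
ear-old-neighbours G u v {x} x≢u x≢v N new₀    a = ⊥-elim (x≢u (does-sound (x ≟ u) a))
ear-old-neighbours G u v {x} x≢u x≢v N new₁    a = ⊥-elim (x≢v (does-sound (x ≟ v) a))
ear-old-neighbours G u v x≢u x≢v N (old t) a with N t a
... | inj₁ e = inj₁ (cong old e)
... | inj₂ e = inj₂ (cong old e)

merge : ∀ {n} → Fin (2 + (2 + n)) → Fin (2 + n)
merge new₀    = new₀
merge new₁    = new₁
merge (old x) = x

merge-Hom : ∀ {n} (G : Graph n) u v → Hom (ear (ear G u v) (old u) (old v)) (ear G u v) merge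
merge-Hom G u v new₀    new₁    _ = refl
merge-Hom G u v new₀    (old y) a with refl ← does-sound (y ≟ old u) a = ear-u G u v
merge-Hom G u v new₁    new₀    _ = refl
merge-Hom G u v new₁    (old y) a with refl ← does-sound (y ≟ old v) a = ear-v G u v
merge-Hom G u v (old x) new₀    a with refl ← does-sound (x ≟ old u) a = ear-u G u v
merge-Hom G u v (old x) new₁    a with refl ← does-sound (x ≟ old v) a = ear-v G u v
merge-Hom G u v (old x) (old y) a = a

liftEar : ∀ {n n′} → (Fin n → Fin n′) → Fin (2 + n) → Fin (2 + n′)
liftEar f new₀    = new₀
liftEar f new₁    = new₁
liftEar f (old x) = old (f x)

liftEar-Hom : ∀ {n n′} {G : Graph n} {G′ : Graph n′} (f : Fin n → Fin n′) → Hom G G′ f → ∀ u v →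
              Hom (ear G u v) (ear G′ (f u) (f v)) (liftEar f)
liftEar-Hom f hom u v new₀    new₁    _ = refl
liftEar-Hom f hom u v new₀    (old y) a with refl ← does-sound (y ≟ u) a = ≟-diag (f u)
liftEar-Hom f hom u v new₁    new₀    _ = refl
liftEar-Hom f hom u v new₁    (old y) a with refl ← does-sound (y ≟ v) a = ≟-diag (f v)
liftEar-Hom f hom u v (old x) new₀    a with refl ← does-sound (x ≟ u) a = ≟-diag (f u)
liftEar-Hom f hom u v (old x) new₁    a with refl ← does-sound (x ≟ v) a = ≟-diag (f v)
liftEar-Hom f hom u v (old x) (old y) a = hom x y a

merge-retract-outer : ∀ {n} (x : Fin (2 + (2 + n))) → ¬ x ≡ new₀ → ¬ x ≡ new₁ → old (merge x) ≡ x
merge-retract-outer new₀    x≢new₀ _ = ⊥-elim (x≢new₀ refl)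
merge-retract-outer new₁    _ x≢new₁ = ⊥-elim (x≢new₁ refl)
merge-retract-outer (old x) _ _      = refl

merge-retract-inner : ∀ {n} (x : Fin (2 + (2 + n))) → ¬ x ≡ old new₀ → ¬ x ≡ old new₁ →
                      liftEar old (merge x) ≡ x
merge-retract-inner new₀          _ _      = refl
merge-retract-inner new₁          _ _      = refl
merge-retract-inner (old new₀)    x≢new₀ _ = ⊥-elim (x≢new₀ refl)
merge-retract-inner (old new₁)    _ x≢new₁ = ⊥-elim (x≢new₁ refl)
merge-retract-inner (old (old x)) _ _      = refl

liftEar-retract : ∀ {n n′} {f : Fin n → Fin n′} {g : Fin n′ → Fin n} x →
                  (∀ y → x ≡ old y → g (f y) ≡ y) → liftEar g (liftEar f x) ≡ x
liftEar-retract new₀    _ = refl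
liftEar-retract new₁    _ = refl
liftEar-retract (old y) r = cong old (r y refl)

module _ {n} (K : Graph n) (u v : Fin n) where
  private
    E₁ : Graph (2 + n)
    E₁ = ear K u v
    E₂ : Graph (4 + n)
    E₂ = ear E₁ (old u) (old v)
    E₃ : Graph (6 + n)
    E₃ = ear E₂ (old (old u)) (old (old v))

    hub other : Fin (6 + n)
    hub   = old (old (old u))
    other = old (old (old v))

    spoke₁ : NeighboursIn E₃ new₀ hub new₁
    spoke₁ = ear-new₀-neighbours E₂ _ _
    spoke₂ : NeighboursIn E₃ (old new₀) hub (old new₁)
    spoke₂ = ear-old-neighbours E₂ _ _ (λ ()) (λ ()) (ear-new₀-neighbours E₁ _ _)
    spoke₃ : NeighboursIn E₃ (old (old new₀)) hub (old (old new₁))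
    spoke₃ = ear-old-neighbours E₂ _ _ (λ ()) (λ ())
               (ear-old-neighbours E₁ _ _ (λ ()) (λ ()) (ear-new₀-neighbours K _ _))

    end₁ : NeighboursIn E₃ new₁ new₀ other
    end₁ = ear-new₁-neighbours E₂ _ _
    end₂ : NeighboursIn E₃ (old new₁) (old new₀) other
    end₂ = ear-old-neighbours E₂ _ _ (λ ()) (λ ()) (ear-new₁-neighbours E₁ _ _)
    end₃ : NeighboursIn E₃ (old (old new₁)) (old (old new₀)) other
    end₃ = ear-old-neighbours E₂ _ _ (λ ()) (λ ())
             (ear-old-neighbours E₁ _ _ (λ ()) (λ ()) (ear-new₁-neighbours K _ _))

    liftEar-merge-Hom : Hom E₃ E₂ (liftEar merge)
    liftEar-merge-Hom = liftEar-Hom {G = E₂} {G′ = E₁} merge (merge-Hom K u v) (old (old u)) (old (old v))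

  -- merge folds the first ear of E₃ onto the second; liftEar merge folds the second and third together.
  ear³-Cycle⇒ear²-Cycle : ∀ {m} → Cycle E₃ m → Cycle E₂ m
  ear³-Cycle⇒ear²-Cycle C
    with any? (λ i → c i ≟ new₀) | any? (λ i → c i ≟ old new₀) | any? (λ i → c i ≟ old (old new₀))
    where open Cycle C
  ... | yes on₁ | yes on₂ | yes on₃ =
    ⊥-elim (Cycle-¬threeSpokes C (λ ()) (λ ()) (λ ()) spoke₁ spoke₂ spoke₃ on₁ on₂ on₃)
  ... | no ¬on₁ | _ | _ = Cycle-map merge (merge-Hom E₁ _ _) C (retract⇒injective merge old retract)
    where
    open Cycle C
    retract : ∀ i → old (merge (c i)) ≡ c i
    retract i = merge-retract-outer (c i)
      (λ e → ¬on₁ (i , e))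
      (λ e → ¬on₁ (OnCycle-neighbour C end₁ (i , e)))
  ... | yes _ | no ¬on₂ | _ =
    Cycle-map (liftEar merge) liftEar-merge-Hom C
      (retract⇒injective (liftEar merge) (liftEar old) retract)
    where
    open Cycle C
    retract : ∀ i → liftEar old (liftEar merge (c i)) ≡ c i
    retract i = liftEar-retract (c i) λ y ci≡y → merge-retract-outer y
      (λ e → ¬on₂ (i , trans ci≡y (cong old e)))
      (λ e → ¬on₂ (OnCycle-neighbour C end₂ (i , trans ci≡y (cong old e))))
  ... | yes _ | yes _ | no ¬on₃ =
    Cycle-map (liftEar merge) liftEar-merge-Hom C
      (retract⇒injective (liftEar merge) (liftEar (liftEar old)) retract)
    where
    open Cycle C
    retract : ∀ i → liftEar (liftEar old) (liftEar merge (c i)) ≡ c i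
    retract i = liftEar-retract (c i) λ y ci≡y → merge-retract-inner y
      (λ e → ¬on₃ (i , trans ci≡y (cong old e)))
      (λ e → ¬on₃ (OnCycle-neighbour C end₃ (i , trans ci≡y (cong old e))))

edgeBound : ℕ → ℕ
edgeBound n = (3 * n ∸ 1) / 2

edgeBound-+2 : ∀ n → 1 ≤ n → edgeBound (2 + n) ≡ 3 + edgeBound n
edgeBound-+2 n 1≤n = begin
  (3 * (2 + n) ∸ 1) / 2  ≡⟨ cong (_/ 2) 3[2+n]∸1≡6+y ⟩
  (6 + y) / 2            ≡⟨ +2/2 (4 + y) ⟩
  1 + (4 + y) / 2        ≡⟨ cong (1 +_) (+2/2 (2 + y)) ⟩
  2 + (2 + y) / 2        ≡⟨ cong (2 +_) (+2/2 y) ⟩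
  3 + y / 2              ∎
  where
  open ≡-Reasoning
  y : ℕ
  y = 3 * n ∸ 1
  +2/2 : ∀ x → (2 + x) / 2 ≡ 1 + x / 2
  +2/2 x = m/n≡1+[m∸n]/n {2 + x} {2} (s≤s (s≤s z≤n))
  3[2+n]∸1≡6+y : 3 * (2 + n) ∸ 1 ≡ 6 + y
  3[2+n]∸1≡6+y =
    trans (cong (_∸ 1) (ℕ.*-distribˡ-+ 3 2 n)) (ℕ.+-∸-assoc 6 (ℕ.≤-trans 1≤n (ℕ.m≤m+n n (2 * n))))

Witness : ℕ → Set
Witness n = Σ (Graph n) (λ G → TwoConnected G × NoCycleLen0mod4 G × edgeCount G ≡ edgeBound n)

module EarTower {n₀} (H : Graph n₀) (u v : Fin n₀) where

  order : ℕ → ℕ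
  order zero    = n₀
  order (suc k) = 2 + order k

  uₖ vₖ : ∀ k → Fin (order k)
  uₖ zero    = u
  uₖ (suc k) = old (uₖ k)
  vₖ zero    = v
  vₖ (suc k) = old (vₖ k)

  tower : ∀ k → Graph (order k)
  tower zero    = H
  tower (suc k) = ear (tower k) (uₖ k) (vₖ k)

  tower-TwoConnected : ¬ u ≡ v → TwoConnected H → ∀ k → TwoConnected (tower k)
  tower-TwoConnected u≢v H-2conn zero    = H-2conn
  tower-TwoConnected u≢v H-2conn (suc k) =
    ear-TwoConnected (tower k) (uₖ k) (vₖ k) (uₖ≢vₖ k) (tower-TwoConnected u≢v H-2conn k)
    where
    uₖ≢vₖ : ∀ k → ¬ uₖ k ≡ vₖ k
    uₖ≢vₖ zero    = u≢v
    uₖ≢vₖ (suc k) e = uₖ≢vₖ k (suc-injective (suc-injective e))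

  tower-edgeCount : 1 ≤ n₀ → edgeCount H ≡ edgeBound n₀ → ∀ k → edgeCount (tower k) ≡ edgeBound (order k)
  tower-edgeCount 1≤n₀ H-edges zero    = H-edges
  tower-edgeCount 1≤n₀ H-edges (suc k) = begin
    edgeCount (tower (suc k))     ≡⟨ edgeCount-ear (tower k) (uₖ k) (vₖ k) ⟩
    3 + edgeCount (tower k)       ≡⟨ cong (3 +_) (tower-edgeCount 1≤n₀ H-edges k) ⟩
    3 + edgeBound (order k)       ≡⟨ sym (edgeBound-+2 (order k) (1≤order k)) ⟩
    edgeBound (order (suc k))     ∎
    where
    open ≡-Reasoning
    1≤order : ∀ k → 1 ≤ order k
    1≤order zero    = 1≤n₀
    1≤order (suc k) = s≤s z≤n

  tower-NoCycleLen0mod4 : NoCycleLen0mod4 (tower 2) → ∀ k → NoCycleLen0mod4 (tower k)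
  tower-NoCycleLen0mod4 ok zero          m 4∣ C = ok m 4∣ (ear-Cycle (ear-Cycle C))
  tower-NoCycleLen0mod4 ok (suc zero)    m 4∣ C = ok m 4∣ (ear-Cycle C)
  tower-NoCycleLen0mod4 ok (suc (suc zero)) = ok
  tower-NoCycleLen0mod4 ok (suc (suc (suc k))) m 4∣ C =
    tower-NoCycleLen0mod4 ok (suc (suc k)) m 4∣ (ear³-Cycle⇒ear²-Cycle (tower k) (uₖ k) (vₖ k) C)

  tower-Witness : ¬ u ≡ v → TwoConnected H → 1 ≤ n₀ → edgeCount H ≡ edgeBound n₀ →
                  NoCycleLen0mod4 (tower 2) → ∀ k → Witness (order k)
  tower-Witness u≢v H-2conn 1≤n₀ H-edges ok k =
    tower k , tower-TwoConnected u≢v H-2conn k , tower-NoCycleLen0mod4 ok k , tower-edgeCount 1≤n₀ H-edges k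

module CycleSearch {N} (G : Graph N) where

  -- The current simple path runs from s to x, has k vertices, and is marked in visited.
  noBadClosing : ℕ → Fin N → Fin N → Vec Bool N → ℕ → Bool
  noBadClosing zero    s x visited k = true
  noBadClosing (suc f) s x visited k =
    not (adj G x s ∧ (k % 4 ≡ᵇ 0)) ∧
    allᵇ (λ y → not (adj G x y) ∨ lookup visited y ∨ noBadClosing f s y (visited [ y ]≔ true) (suc k))

  noCycleLen0mod4ᵇ : Bool
  noCycleLen0mod4ᵇ = allᵇ (λ s → noBadClosing (suc N) s s (replicate N false [ s ]≔ true) 1)

  module _ {m} (C : Cycle G m) (4∣L : 4 ∣ 3 + m) where
    open Cycle C

    L : ℕ
    L = 3 + m

    at : ∀ j → .(j < L) → Fin N
    at j p = c (fromℕ< p)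

    at-injective : ∀ {i j} .(p : i < L) .(q : j < L) → at i p ≡ at j q → i ≡ j
    at-injective p q e = fromℕ<-injective _ _ p q (inj e)

    at-step : ∀ {j} .(p : j < L) .(q : suc j < L) → Adj G (at j p) (at (suc j) q)
    at-step {j} p q = subst (λ i → Adj G (c i) (at (suc j) q)) inject₁-fromℕ< (consec (fromℕ< (s<s⁻¹ q)))
      where
      inject₁-fromℕ< : inject₁ (fromℕ< (s<s⁻¹ q)) ≡ fromℕ< p
      inject₁-fromℕ< = toℕ-injective (trans (toℕ-inject₁ _) (trans (toℕ-fromℕ< _) (sym (toℕ-fromℕ< _))))

    at-close : ∀ .(p : 2 + m < L) → Adj G (at (2 + m) p) (c zero)
    at-close p = subst (λ i → Adj G (c i) (c zero)) fromℕ≡fromℕ< close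
      where
      fromℕ≡fromℕ< : fromℕ (2 + m) ≡ fromℕ< p
      fromℕ≡fromℕ< = toℕ-injective (trans (toℕ-fromℕ (2 + m)) (sym (toℕ-fromℕ< p)))

    -- Following the cycle from c zero, the search must reach its last vertex with k = L.
    follow : ∀ f j visited (p : j < L) → L ≤ f + j →
             (∀ i .(q : i < L) → j < i → lookup visited (at i q) ≡ false) →
             noBadClosing f (c zero) (at j p) visited (suc j) ≡ true → ⊥
    follow zero j _ p L≤j _ _ = ℕ.<-irrefl refl (ℕ.<-≤-trans p L≤j)
    follow (suc f) j visited p L≤ fresh ok with j ℕ.≟ 2 + m
    ... | yes refl = closes-bad (∧-conicalˡ _ _ ok)
      where
      closes-bad : not (adj G (at j p) (c zero) ∧ (L % 4 ≡ᵇ 0)) ≡ true → ⊥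
      closes-bad rewrite at-close p | n∣m⇒m%n≡0 L 4 4∣L = λ ()
    ... | no j≢2+m = follow f (suc j) (visited [ y ]≔ true) q L≤′ fresh′ ok′
      where
      q : suc j < L
      q = s≤s (ℕ.≤∧≢⇒< (s≤s⁻¹ p) j≢2+m)
      y : Fin N
      y = at (suc j) q
      L≤′ : L ≤ f + suc j
      L≤′ = subst (L ≤_) (sym (ℕ.+-suc f j)) L≤
      fresh′ : ∀ i .(r : i < L) → suc j < i → lookup (visited [ y ]≔ true) (at i r) ≡ false
      fresh′ i r j+1<i = trans (lookup∘update′ at-i≢y visited true) (fresh i r (ℕ.<-trans (ℕ.n<1+n j) j+1<i))
        where
        at-i≢y : ¬ at i r ≡ y
        at-i≢y e = ℕ.<-irrefl (at-injective {suc j} {i} q r (sym e)) j+1<i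
      ok′ : noBadClosing f (c zero) y (visited [ y ]≔ true) (suc (suc j)) ≡ true
      ok′ = extend (allᵇ-sound _ (∧-conicalʳ _ _ ok) y) (at-step p q) (fresh (suc j) q (ℕ.n<1+n j))
        where
        extend : ∀ {a b r} → (not a ∨ b ∨ r) ≡ true → a ≡ true → b ≡ false → r ≡ true
        extend e refl refl = e

    noCycleLen0mod4ᵇ-refutes : noCycleLen0mod4ᵇ ≡ true → ⊥
    noCycleLen0mod4ᵇ-refutes ok = follow (suc N) 0 visited₀ (s≤s z≤n) L≤1+N fresh₀ (allᵇ-sound _ ok (c zero))
      where
      visited₀ : Vec Bool N
      visited₀ = replicate N false [ c zero ]≔ true
      L≤1+N : L ≤ suc N + 0
      L≤1+N = ℕ.m≤n⇒m≤1+n (subst (L ≤_) (sym (ℕ.+-identityʳ N)) (injective⇒≤ inj))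
      fresh₀ : ∀ i .(q : i < L) → 0 < i → lookup visited₀ (at i q) ≡ false
      fresh₀ i q 0<i = trans (lookup∘update′ at-i≢c₀ (replicate N false) true) (lookup-replicate (at i q) false)
        where
        at-i≢c₀ : ¬ at i q ≡ c zero
        at-i≢c₀ e = ℕ.<-irrefl (sym (at-injective {i} {0} q (s≤s z≤n) e)) 0<i

  noCycleLen0mod4ᵇ⇒NoCycleLen0mod4 : noCycleLen0mod4ᵇ ≡ true → NoCycleLen0mod4 G
  noCycleLen0mod4ᵇ⇒NoCycleLen0mod4 ok m 4∣L C = noCycleLen0mod4ᵇ-refutes C 4∣L ok

module SpanningTree {N} (G : Graph N) {P : Fin N → Set} (P? : ∀ x → Dec (P x))
                    (root : Fin N) (parent : Fin N → Fin N) where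

  reachesRoot : ℕ → Fin N → Bool
  reachesRoot zero    x = false
  reachesRoot (suc f) x =
    does (P? x) ∧ (does (x ≟ root) ∨ (adj G x (parent x) ∧ reachesRoot f (parent x)))

  reachesRoot-sound : ∀ f x → reachesRoot f x ≡ true → Reach G P x root
  reachesRoot-sound (suc f) x ok with P? x | x ≟ root
  ... | yes px | yes refl = here px
  ... | yes px | no _     = step px (∧-conicalˡ _ _ ok) (reachesRoot-sound f (parent x) (∧-conicalʳ _ _ ok))

  spanningᵇ : Bool
  spanningᵇ = allᵇ (λ x → not (does (P? x)) ∨ reachesRoot N x)

  spanningᵇ⇒ConnectedOn : spanningᵇ ≡ true → ConnectedOn G P
  spanningᵇ⇒ConnectedOn ok = connectedOn-viaRoot root λ x px →
    reachesRoot-sound N x (modusPonensᵇ (allᵇ-sound _ ok x) (dec-true (P? x) px))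

-- A certificate consists of spanning trees (root and parent map) of G and of every G − w.
twoConnectedᵇ : ∀ {N} (G : Graph N) → Fin N → (Fin N → Fin N) →
                (Fin N → Fin N) → (Fin N → Fin N → Fin N) → Bool
twoConnectedᵇ G root parent root′ parent′ =
  SpanningTree.spanningᵇ G (λ _ → yes tt) root parent ∧
  allᵇ (λ w → SpanningTree.spanningᵇ G (λ z → ¬? (z ≟ w)) (root′ w) (parent′ w))

twoConnectedᵇ-sound : ∀ {N} (G : Graph N) root parent root′ parent′ → 3 ≤ N →
                      twoConnectedᵇ G root parent root′ parent′ ≡ true → TwoConnected G
twoConnectedᵇ-sound G root parent root′ parent′ 3≤N ok =
  3≤N ,
  SpanningTree.spanningᵇ⇒ConnectedOn G _ root parent (∧-conicalˡ _ _ ok) ,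
  λ w → SpanningTree.spanningᵇ⇒ConnectedOn G _ (root′ w) (parent′ w) (allᵇ-sound _ (∧-conicalʳ _ _ ok) w)

fromMatrix : ∀ {N} (M : Vec (Vec Bool N) N) →
             allᵇ (λ i → allᵇ (λ j → does (lookup (lookup M i) j ≟ᵇ lookup (lookup M j) i))) ≡ true →
             allᵇ (λ i → not (lookup (lookup M i) i)) ≡ true → Graph N
fromMatrix M symmetric irreflexive = record
  { adj    = λ i j → lookup (lookup M i) j
  ; sym    = λ i j → does-sound (_ ≟ᵇ _) (allᵇ-sound _ (allᵇ-sound _ symmetric i) j)
  ; irrefl = λ i → trans (sym (not-involutive _)) (cong not (allᵇ-sound _ irreflexive i))
  }

rootAvoiding : ∀ {N} → Fin (2 + N) → Fin (2 + N)
rootAvoiding zero    = suc zero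
rootAvoiding (suc _) = zero

M₈ : Vec (Vec Bool 8) 8
M₈ =
  (false ∷ false ∷ true ∷ true ∷ true ∷ true ∷ false ∷ false ∷ [])
  ∷ (false ∷ false ∷ true ∷ false ∷ false ∷ false ∷ true ∷ true ∷ [])
  ∷ (true ∷ true ∷ false ∷ true ∷ false ∷ false ∷ false ∷ false ∷ [])
  ∷ (true ∷ false ∷ true ∷ false ∷ false ∷ false ∷ false ∷ false ∷ [])
  ∷ (true ∷ false ∷ false ∷ false ∷ false ∷ true ∷ true ∷ false ∷ [])
  ∷ (true ∷ false ∷ false ∷ false ∷ true ∷ false ∷ false ∷ true ∷ [])
  ∷ (false ∷ true ∷ false ∷ false ∷ true ∷ false ∷ false ∷ false ∷ [])
  ∷ (false ∷ true ∷ false ∷ false ∷ false ∷ true ∷ false ∷ false ∷ [])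
  ∷ []

H₈ : Graph 8
H₈ = fromMatrix M₈ refl refl

parent₈ : Vec (Fin 8) 8
parent₈ = (# 0 ∷ # 2 ∷ # 0 ∷ # 0 ∷ # 0 ∷ # 0 ∷ # 4 ∷ # 5 ∷ [])

parentAvoiding₈ : Vec (Vec (Fin 8) 8) 8
parentAvoiding₈ =
  (# 1 ∷ # 1 ∷ # 1 ∷ # 2 ∷ # 6 ∷ # 7 ∷ # 1 ∷ # 1 ∷ [])
  ∷ (# 0 ∷ # 0 ∷ # 0 ∷ # 0 ∷ # 0 ∷ # 0 ∷ # 4 ∷ # 5 ∷ [])
  ∷ (# 0 ∷ # 6 ∷ # 0 ∷ # 0 ∷ # 0 ∷ # 0 ∷ # 4 ∷ # 5 ∷ [])
  ∷ (# 0 ∷ # 2 ∷ # 0 ∷ # 0 ∷ # 0 ∷ # 0 ∷ # 4 ∷ # 5 ∷ [])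
  ∷ (# 0 ∷ # 2 ∷ # 0 ∷ # 0 ∷ # 0 ∷ # 0 ∷ # 1 ∷ # 5 ∷ [])
  ∷ (# 0 ∷ # 2 ∷ # 0 ∷ # 0 ∷ # 0 ∷ # 0 ∷ # 4 ∷ # 1 ∷ [])
  ∷ (# 0 ∷ # 2 ∷ # 0 ∷ # 0 ∷ # 0 ∷ # 0 ∷ # 0 ∷ # 5 ∷ [])
  ∷ (# 0 ∷ # 2 ∷ # 0 ∷ # 0 ∷ # 0 ∷ # 0 ∷ # 4 ∷ # 0 ∷ [])
  ∷ []

H₈-TwoConnected : TwoConnected H₈
H₈-TwoConnected = twoConnectedᵇ-sound H₈ zero (lookup parent₈) rootAvoiding (lookup ∘ lookup parentAvoiding₈)
  (s≤s (s≤s (s≤s z≤n))) refl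

M₁₃ : Vec (Vec Bool 13) 13
M₁₃ =
  (false ∷ false ∷ true ∷ true ∷ false ∷ false ∷ false ∷ false ∷ true ∷ true ∷ false ∷ false ∷ false ∷ [])
  ∷ (false ∷ false ∷ true ∷ false ∷ false ∷ false ∷ false ∷ true ∷ false ∷ false ∷ false ∷ false ∷ true ∷ [])
  ∷ (true ∷ true ∷ false ∷ true ∷ false ∷ false ∷ true ∷ false ∷ false ∷ false ∷ true ∷ false ∷ false ∷ [])
  ∷ (true ∷ false ∷ true ∷ false ∷ true ∷ false ∷ false ∷ false ∷ false ∷ false ∷ false ∷ false ∷ false ∷ [])
  ∷ (false ∷ false ∷ false ∷ true ∷ false ∷ true ∷ false ∷ false ∷ false ∷ false ∷ false ∷ true ∷ false ∷ [])
  ∷ (false ∷ false ∷ false ∷ false ∷ true ∷ false ∷ true ∷ false ∷ false ∷ false ∷ false ∷ true ∷ false ∷ [])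
  ∷ (false ∷ false ∷ true ∷ false ∷ false ∷ true ∷ false ∷ false ∷ false ∷ false ∷ false ∷ false ∷ false ∷ [])
  ∷ (false ∷ true ∷ false ∷ false ∷ false ∷ false ∷ false ∷ false ∷ true ∷ false ∷ false ∷ false ∷ false ∷ [])
  ∷ (true ∷ false ∷ false ∷ false ∷ false ∷ false ∷ false ∷ true ∷ false ∷ true ∷ false ∷ false ∷ false ∷ [])
  ∷ (true ∷ false ∷ false ∷ false ∷ false ∷ false ∷ false ∷ false ∷ true ∷ false ∷ false ∷ false ∷ true ∷ [])
  ∷ (false ∷ false ∷ true ∷ false ∷ false ∷ false ∷ false ∷ false ∷ false ∷ false ∷ false ∷ true ∷ false ∷ [])
  ∷ (false ∷ false ∷ false ∷ false ∷ true ∷ true ∷ false ∷ false ∷ false ∷ false ∷ true ∷ false ∷ false ∷ [])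
  ∷ (false ∷ true ∷ false ∷ false ∷ false ∷ false ∷ false ∷ false ∷ false ∷ true ∷ false ∷ false ∷ false ∷ [])
  ∷ []

H₁₃ : Graph 13
H₁₃ = fromMatrix M₁₃ refl refl

parent₁₃ : Vec (Fin 13) 13
parent₁₃ = (# 0 ∷ # 2 ∷ # 0 ∷ # 0 ∷ # 3 ∷ # 6 ∷ # 2 ∷ # 8 ∷ # 0 ∷ # 0 ∷ # 2 ∷ # 10 ∷ # 9 ∷ [])

parentAvoiding₁₃ : Vec (Vec (Fin 13) 13) 13
parentAvoiding₁₃ =
  (# 1 ∷ # 1 ∷ # 1 ∷ # 2 ∷ # 3 ∷ # 6 ∷ # 2 ∷ # 1 ∷ # 7 ∷ # 12 ∷ # 2 ∷ # 10 ∷ # 1 ∷ [])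
  ∷ (# 0 ∷ # 0 ∷ # 0 ∷ # 0 ∷ # 3 ∷ # 6 ∷ # 2 ∷ # 8 ∷ # 0 ∷ # 0 ∷ # 2 ∷ # 10 ∷ # 9 ∷ [])
  ∷ (# 0 ∷ # 7 ∷ # 0 ∷ # 0 ∷ # 3 ∷ # 4 ∷ # 5 ∷ # 8 ∷ # 0 ∷ # 0 ∷ # 11 ∷ # 4 ∷ # 9 ∷ [])
  ∷ (# 0 ∷ # 2 ∷ # 0 ∷ # 0 ∷ # 5 ∷ # 6 ∷ # 2 ∷ # 8 ∷ # 0 ∷ # 0 ∷ # 2 ∷ # 10 ∷ # 9 ∷ [])
  ∷ (# 0 ∷ # 2 ∷ # 0 ∷ # 0 ∷ # 0 ∷ # 6 ∷ # 2 ∷ # 8 ∷ # 0 ∷ # 0 ∷ # 2 ∷ # 10 ∷ # 9 ∷ [])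
  ∷ (# 0 ∷ # 2 ∷ # 0 ∷ # 0 ∷ # 3 ∷ # 0 ∷ # 2 ∷ # 8 ∷ # 0 ∷ # 0 ∷ # 2 ∷ # 10 ∷ # 9 ∷ [])
  ∷ (# 0 ∷ # 2 ∷ # 0 ∷ # 0 ∷ # 3 ∷ # 4 ∷ # 0 ∷ # 8 ∷ # 0 ∷ # 0 ∷ # 2 ∷ # 10 ∷ # 9 ∷ [])
  ∷ (# 0 ∷ # 2 ∷ # 0 ∷ # 0 ∷ # 3 ∷ # 6 ∷ # 2 ∷ # 0 ∷ # 0 ∷ # 0 ∷ # 2 ∷ # 10 ∷ # 9 ∷ [])
  ∷ (# 0 ∷ # 2 ∷ # 0 ∷ # 0 ∷ # 3 ∷ # 6 ∷ # 2 ∷ # 1 ∷ # 0 ∷ # 0 ∷ # 2 ∷ # 10 ∷ # 9 ∷ [])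
  ∷ (# 0 ∷ # 2 ∷ # 0 ∷ # 0 ∷ # 3 ∷ # 6 ∷ # 2 ∷ # 8 ∷ # 0 ∷ # 0 ∷ # 2 ∷ # 10 ∷ # 1 ∷ [])
  ∷ (# 0 ∷ # 2 ∷ # 0 ∷ # 0 ∷ # 3 ∷ # 6 ∷ # 2 ∷ # 8 ∷ # 0 ∷ # 0 ∷ # 0 ∷ # 4 ∷ # 9 ∷ [])
  ∷ (# 0 ∷ # 2 ∷ # 0 ∷ # 0 ∷ # 3 ∷ # 6 ∷ # 2 ∷ # 8 ∷ # 0 ∷ # 0 ∷ # 2 ∷ # 0 ∷ # 9 ∷ [])
  ∷ (# 0 ∷ # 2 ∷ # 0 ∷ # 0 ∷ # 3 ∷ # 6 ∷ # 2 ∷ # 8 ∷ # 0 ∷ # 0 ∷ # 2 ∷ # 10 ∷ # 0 ∷ [])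
  ∷ []

H₁₃-TwoConnected : TwoConnected H₁₃
H₁₃-TwoConnected = twoConnectedᵇ-sound H₁₃ zero (lookup parent₁₃) rootAvoiding (lookup ∘ lookup parentAvoiding₁₃)
  (s≤s (s≤s (s≤s z≤n))) refl

module Tower₈  = EarTower H₈  zero (suc zero)
module Tower₁₃ = EarTower H₁₃ zero (suc zero)

witness₈ : ∀ k → Witness (Tower₈.order k)
witness₈ = Tower₈.tower-Witness (λ ()) H₈-TwoConnected (s≤s z≤n) refl
  (CycleSearch.noCycleLen0mod4ᵇ⇒NoCycleLen0mod4 (Tower₈.tower 2) refl)

witness₁₃ : ∀ k → Witness (Tower₁₃.order k)
witness₁₃ = Tower₁₃.tower-Witness (λ ()) H₁₃-TwoConnected (s≤s z≤n) refl
  (CycleSearch.noCycleLen0mod4ᵇ⇒NoCycleLen0mod4 (Tower₁₃.tower 2) refl)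

orders-cover : ∀ j → (∃ λ k → Tower₈.order k ≡ 12 + j) ⊎ (∃ λ k → Tower₁₃.order k ≡ 12 + j)
orders-cover zero          = inj₁ (2 , refl)
orders-cover (suc zero)    = inj₂ (0 , refl)
orders-cover (suc (suc j)) with orders-cover j
... | inj₁ (k , e) = inj₁ (suc k , cong (2 +_) e)
... | inj₂ (k , e) = inj₂ (suc k , cong (2 +_) e)

mainTheorem5 : ∀ (n : ℕ) → 12 ≤ n →
    Σ (Graph n) (λ G → TwoConnected G × NoCycleLen0mod4 G × edgeCount G ≡ (3 * n ∸ 1) / 2)
mainTheorem5 n 12≤n with orders-cover (n ∸ 12)
... | inj₁ (k , e) = subst Witness (trans e (ℕ.m+[n∸m]≡n 12≤n)) (witness₈ k)
... | inj₂ (k , e) = subst Witness (trans e (ℕ.m+[n∸m]≡n 12≤n)) (witness₁₃ k)
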